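{- Let $G$ be a simple graph and let $s,s'$ be words over $V(G)$, both reduced with respect to $G$, such that $s'\in\mathrm{Loc}_G(s)$. Then $V(s)=V(s')$.
   Context: For a simple graph $G$ and $u\in V(G)$, $Gu$ has edge set $E(G)\triangle\{[x,y]:x\ne y\in N_G(u)\}$; $Gu_1\cdots u_k=(\cdots(Gu_1)\cdots)u_k$. $V(s)$ is the set of letters of $s$. A word $s$ is reduced with respect to $G$ if $s=s_1\cdots s_n$ where the letter sets of the blocks $s_i$ are pairwise disjoint and each $s_i$ is a single vertex or a word $uvu$ with $u\ne v$, $[u,v]\in E(Gs_1\cdots s_{i-1})$. $\mathrm{Loc}_G(s)$ is the set of words obtainable from $s$ by finitely many steps replacing $prq$ by $pq$ or $pq$ by $prq$ where, with $H=Gp$, $r$ is one of: $uu$; $uvuv$ with $u\ne v$ non-adjacent in $H$; $uvuvuv$ with $[u,v]\in E(H)$; $uvuvwvuwu$ with $u,v,w$ pairwise adjacent in $H$. -}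

module Defs where

open import Data.Bool using (Bool; true; false; not; _∧_; _xor_)
open import Data.List using (List; []; _∷_; _++_; foldl; concatMap)
open import Data.List.Membership.Propositional using (_∈_)
open import Data.List.Relation.Unary.AllPairs using (AllPairs)
open import Data.Product using (Σ; _×_; ∃)
open import Data.Sum using (_⊎_)
open import Data.Unit using (⊤)
open import Data.Empty using (⊥)
open import Relation.Nullary using (¬_)
open import Relation.Nullary.Decidable using (⌊_⌋)
open import Relation.Binary.Definitions using (DecidableEquality)
open import Relation.Binary.PropositionalEquality using (_≡_; _≢_)
open import Relation.Binary.Construct.Closure.ReflexiveTransitive using (Star)

Graph : Set → Set
Graph V = V → V → Bool

SimpleGraph : {V : Set} → Graph V → Set
SimpleGraph {V} G = (∀ (x y : V) → G x y ≡ G y x) × (∀ (x : V) → G x x ≡ false)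

module _ {V : Set} (_≟_ : DecidableEquality V) where

  lc : Graph V → V → Graph V
  lc G u x y = G x y xor (not ⌊ x ≟ y ⌋ ∧ (G u x ∧ G u y))

  lcWord : Graph V → List V → Graph V
  lcWord G s = foldl lc G s

  -- letter set V(s) is represented by membership; V(s) = V(s') as equal membership
  SameLetters : List V → List V → Set
  SameLetters s t = ∀ x → (x ∈ s → x ∈ t) × (x ∈ t → x ∈ s)

  data Block : Set where
    single : V → Block
    triple : V → V → Block

  blockWord : Block → List V
  blockWord (single u) = u ∷ []
  blockWord (triple u v) = u ∷ v ∷ u ∷ []

  ValidBlock : Graph V → Block → Set
  ValidBlock G (single u) = ⊤
  ValidBlock G (triple u v) = u ≢ v × G u v ≡ true

  ValidBlocks : Graph V → List Block → Set
  ValidBlocks G [] = ⊤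
  ValidBlocks G (b ∷ bs) = ValidBlock G b × ValidBlocks (lcWord G (blockWord b)) bs

  DisjointLetters : Block → Block → Set
  DisjointLetters b c = ∀ x → x ∈ blockWord b → x ∈ blockWord c → ⊥

  Reduced : Graph V → List V → Set
  Reduced G s = Σ (List Block) λ bs →
    (concatMap blockWord bs ≡ s) × ValidBlocks G bs × AllPairs DisjointLetters bs

  data Relator (H : Graph V) : List V → Set where
    r-uu     : ∀ u → Relator H (u ∷ u ∷ [])
    r-uvuv   : ∀ u v → u ≢ v → H u v ≡ false → Relator H (u ∷ v ∷ u ∷ v ∷ [])
    r-uvuvuv : ∀ u v → H u v ≡ true → Relator H (u ∷ v ∷ u ∷ v ∷ u ∷ v ∷ [])
    r-uvw    : ∀ u v w → H u v ≡ true → H v w ≡ true → H u w ≡ true →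
               Relator H (u ∷ v ∷ u ∷ v ∷ w ∷ v ∷ u ∷ w ∷ u ∷ [])

  data LocStep (G : Graph V) : List V → List V → Set where
    remove : ∀ p r q → Relator (lcWord G p) r → LocStep G (p ++ r ++ q) (p ++ q)
    insert : ∀ p r q → Relator (lcWord G p) r → LocStep G (p ++ q) (p ++ r ++ q)

  InLoc : Graph V → List V → List V → Set
  InLoc G s t = Star (LocStep G) s t

-- Every vertex carries a label in 𝔽₂², initially (0,1).  Local complementation at u
-- applies the transvection (r,s) ↦ (r+s,s) to the label of u and (r,s) ↦ (r,r+s) to the
-- labels of the neighbours of u.  Every relator of Loc leaves the graph and all labels
-- unchanged; a relator has at most three letters and a graph entry or a label observes at
-- most two further vertices, so this is verified by enumerating all simple graphs on at
-- most five vertices.  The second transvection fixes (0,1) and the first moves it, so a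
-- block u or uvu moves the labels of its own letters away from (0,1) for good, while
-- vertices outside the word keep (0,1).  Hence the letters of a reduced word are exactly
-- the vertices whose final label is not (0,1), an invariant of Loc.
module Submission where

open import Defs
open import Data.List using (List)
open import Relation.Binary.Definitions using (DecidableEquality)

open import Data.Bool using (Bool; true; false; not; _∧_; _xor_; if_then_else_; T)
import Data.Bool.Properties as Bool
open import Data.Empty using (⊥-elim)
open import Data.Fin using (Fin; zero; suc; _↑ʳ_)
import Data.Fin.Properties as Fin
open import Data.List using ([]; _∷_; _++_; map; foldl; concatMap)
open import Data.List.Properties using (map-cong; map-∘)
open import Data.List.Membership.Propositional using (_∈_; _∉_)
open import Data.List.Membership.Propositional.Properties using (∈-++⁻)
import Data.List.Membership.DecPropositional as DecMembership
open import Data.List.Relation.Unary.All using (All; []; _∷_; all?) renaming (map to All-map)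
open import Data.List.Relation.Unary.AllPairs using (AllPairs; []; _∷_)
open import Data.List.Relation.Unary.Any using (here; there)
open import Data.Nat using (ℕ; zero; suc; _+_)
open import Data.Product using (_×_; _,_; proj₁; proj₂; ∃)
import Data.Product.Properties as Product
open import Data.Sum using (_⊎_; inj₁; inj₂)
open import Data.Unit using (⊤; tt)
open import Data.Vec using (Vec; []; _∷_; lookup; tabulate; replicate) renaming (_++_ to _++ᵛ_)
open import Data.Vec.Properties using (lookup∘tabulate; lookup-++ʳ; lookup-replicate)
import Data.Vec.Relation.Unary.All as Vec
open import Data.Vec.Relation.Unary.AllPairs using ([]; _∷_)
open import Data.Vec.Relation.Unary.Unique.Propositional using (Unique)
open import Data.Vec.Relation.Unary.Unique.Propositional.Properties using (lookup-injective)
open import Function using (_∘_; _⇔_; mk⇔; Equivalence)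
open import Relation.Nullary using (Dec; yes; no)
open import Relation.Nullary.Decidable using (⌊_⌋; isYes≗does; does-⇔; fromWitness; toWitness)
open import Relation.Binary.PropositionalEquality
open import Relation.Binary.Construct.Closure.ReflexiveTransitive using (ε; _◅_)

⌊⌋-⇔ : ∀ {A B : Set} (a? : Dec A) (b? : Dec B) → A ⇔ B → ⌊ a? ⌋ ≡ ⌊ b? ⌋
⌊⌋-⇔ a? b? A⇔B = trans (isYes≗does a?) (trans (does-⇔ A⇔B a? b?) (sym (isYes≗does b?)))

if-true : ∀ {c d} → T c → T (if c then d else true) → T d
if-true {true} _ d = d

∧-split : ∀ {a b} → T (a ∧ b) → T a × T b
∧-split = Equivalence.to Bool.T-∧

_≐_ : {V : Set} → Graph V → Graph V → Set
G ≐ H = ∀ x y → G x y ≡ H x y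

comap : {A V : Set} → (A → V) → Graph V → Graph A
comap ι G a b = G (ι a) (ι b)

comap-simple : {A V : Set} (ι : A → V) {G : Graph V} → SimpleGraph G → SimpleGraph (comap ι G)
comap-simple ι (symmetric , loopless) = (λ a b → symmetric (ι a) (ι b)) , loopless ∘ ι

adjacent⇒≢ : {V : Set} {G : Graph V} → SimpleGraph G → ∀ {u v} → G u v ≡ true → u ≢ v
adjacent⇒≢ (_ , loopless) {u} uv refl with () ← trans (sym (loopless u)) uv

Label : Set
Label = Bool × Bool

_≟ᴸ_ : DecidableEquality Label
_≟ᴸ_ = Product.≡-dec Bool._≟_ Bool._≟_

transvectCentre : Label → Label
transvectCentre (r , s) = r xor s , s

transvectNeighbour : Label → Label
transvectNeighbour (r , s) = r , r xor s

initial : Label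
initial = false , true

isInitial : Label → Bool
isInitial (r , s) = not r ∧ s

isInitial-transvectNeighbour : ∀ ℓ → isInitial (transvectNeighbour ℓ) ≡ isInitial ℓ
isInitial-transvectNeighbour (false , s) = refl
isInitial-transvectNeighbour (true , s) = refl

isInitial⇒≡initial : ∀ {ℓ} → isInitial ℓ ≡ true → ℓ ≡ initial
isInitial⇒≡initial {false , true} _ = refl

-- Local complementation and the labels it carries along

module LocalComplementation {V : Set} (_≟_ : DecidableEquality V) where

  lc-cong : ∀ {G H} → G ≐ H → ∀ u → lc _≟_ G u ≐ lc _≟_ H u
  lc-cong G≐H u x y rewrite G≐H x y | G≐H u x | G≐H u y = refl

  lcWord-cong : ∀ {G H} → G ≐ H → ∀ w → lcWord _≟_ G w ≐ lcWord _≟_ H w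
  lcWord-cong G≐H []      = G≐H
  lcWord-cong G≐H (u ∷ w) = lcWord-cong (lc-cong G≐H u) w

  lc-simple : ∀ {G} → SimpleGraph G → ∀ u → SimpleGraph (lc _≟_ G u)
  lc-simple {G} (symmetric , loopless) u = symmetric′ , loopless′
    where
    symmetric′ : ∀ x y → lc _≟_ G u x y ≡ lc _≟_ G u y x
    symmetric′ x y
      rewrite symmetric x y | ⌊⌋-⇔ (x ≟ y) (y ≟ x) (mk⇔ sym sym) | Bool.∧-comm (G u x) (G u y) = refl
    loopless′ : ∀ x → lc _≟_ G u x x ≡ false
    loopless′ x with x ≟ x
    ... | yes _   rewrite loopless x = refl
    ... | no x≢x  = ⊥-elim (x≢x refl)

  lcWord-simple : ∀ {G} → SimpleGraph G → ∀ w → SimpleGraph (lcWord _≟_ G w)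
  lcWord-simple simple []      = simple
  lcWord-simple simple (u ∷ w) = lcWord-simple (lc-simple simple u) w

  lc-at-centre : ∀ {G} → SimpleGraph G → ∀ u x → lc _≟_ G u x u ≡ G x u
  lc-at-centre {G} (_ , loopless) u x
    rewrite loopless u | Bool.∧-zeroʳ (G u x) | Bool.∧-zeroʳ (not ⌊ x ≟ u ⌋) = Bool.xor-identityʳ (G x u)

  act : Graph V → V → V → Label → Label
  act G u x ℓ = if ⌊ x ≟ u ⌋ then transvectCentre ℓ else if G u x then transvectNeighbour ℓ else ℓ

  labelAfter : Graph V → List V → V → Label → Label
  labelAfter G []      x ℓ = ℓ
  labelAfter G (u ∷ w) x ℓ = labelAfter (lc _≟_ G u) w x (act G u x ℓ)

  labelAfter-cong : ∀ {G H} → G ≐ H → ∀ w x ℓ → labelAfter G w x ℓ ≡ labelAfter H w x ℓ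
  labelAfter-cong G≐H []      x ℓ = refl
  labelAfter-cong G≐H (u ∷ w) x ℓ =
    trans (cong (λ b → labelAfter _ w x (if ⌊ x ≟ u ⌋ then _ else if b then _ else ℓ)) (G≐H u x))
          (labelAfter-cong (lc-cong G≐H u) w x _)

  labelAfter-++ : ∀ G p q x ℓ →
    labelAfter G (p ++ q) x ℓ ≡ labelAfter (lcWord _≟_ G p) q x (labelAfter G p x ℓ)
  labelAfter-++ G []      q x ℓ = refl
  labelAfter-++ G (u ∷ p) q x ℓ = labelAfter-++ (lc _≟_ G u) p q x (act G u x ℓ)

  act-self : ∀ G u ℓ → act G u u ℓ ≡ transvectCentre ℓ
  act-self G u ℓ with u ≟ u
  ... | yes _   = refl
  ... | no u≢u  = ⊥-elim (u≢u refl)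

  act-neighbour : ∀ G {u x} ℓ → x ≢ u → G u x ≡ true → act G u x ℓ ≡ transvectNeighbour ℓ
  act-neighbour G {u} {x} ℓ x≢u ux with x ≟ u
  ... | yes x≡u = ⊥-elim (x≢u x≡u)
  ... | no _    rewrite ux = refl

  isInitial-act : ∀ G {u x} ℓ → x ≢ u → isInitial (act G u x ℓ) ≡ isInitial ℓ
  isInitial-act G {u} {x} ℓ x≢u with x ≟ u | G u x
  ... | yes x≡u | _     = ⊥-elim (x≢u x≡u)
  ... | no _    | true  = isInitial-transvectNeighbour ℓ
  ... | no _    | false = refl

  act-initial : ∀ G {u x} → x ≢ u → act G u x initial ≡ initial
  act-initial G x≢u = isInitial⇒≡initial (isInitial-act G initial x≢u)

  labelAfter-∉ : ∀ G {w x} ℓ → x ∉ w → isInitial (labelAfter G w x ℓ) ≡ isInitial ℓ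
  labelAfter-∉ G {[]}    ℓ _   = refl
  labelAfter-∉ G {u ∷ w} ℓ x∉w =
    trans (labelAfter-∉ (lc _≟_ G u) _ (x∉w ∘ there)) (isInitial-act G ℓ (x∉w ∘ here))

module Comap {V : Set} (_≟_ : DecidableEquality V) {n : ℕ} (ι : Fin n → V)
             (ι-injective : ∀ {a b} → ι a ≡ ι b → a ≡ b) where
  open LocalComplementation

  comap-lc : ∀ G c → comap ι (lc _≟_ G (ι c)) ≐ lc Fin._≟_ (comap ι G) c
  comap-lc G c a b rewrite ⌊⌋-⇔ (ι a ≟ ι b) (a Fin.≟ b) (mk⇔ ι-injective (cong ι)) = refl

  comap-lcWord : ∀ G w → comap ι (lcWord _≟_ G (map ι w)) ≐ lcWord Fin._≟_ (comap ι G) w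
  comap-lcWord G []      a b = refl
  comap-lcWord G (c ∷ w) a b =
    trans (comap-lcWord (lc _≟_ G (ι c)) w a b) (lcWord-cong Fin._≟_ (comap-lc G c) w a b)

  comap-act : ∀ G c a ℓ → act _≟_ G (ι c) (ι a) ℓ ≡ act Fin._≟_ (comap ι G) c a ℓ
  comap-act G c a ℓ rewrite ⌊⌋-⇔ (ι a ≟ ι c) (a Fin.≟ c) (mk⇔ ι-injective (cong ι)) = refl

  comap-labelAfter : ∀ G w a ℓ →
    labelAfter _≟_ G (map ι w) (ι a) ℓ ≡ labelAfter Fin._≟_ (comap ι G) w a ℓ
  comap-labelAfter G []      a ℓ = refl
  comap-labelAfter G (c ∷ w) a ℓ = begin
    labelAfter _≟_ (lc _≟_ G (ι c)) (map ι w) (ι a) (act _≟_ G (ι c) (ι a) ℓ)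
      ≡⟨ comap-labelAfter (lc _≟_ G (ι c)) w a _ ⟩
    labelAfter Fin._≟_ (comap ι (lc _≟_ G (ι c))) w a (act _≟_ G (ι c) (ι a) ℓ)
      ≡⟨ labelAfter-cong Fin._≟_ (comap-lc G c) w a _ ⟩
    labelAfter Fin._≟_ (lc Fin._≟_ (comap ι G) c) w a (act _≟_ G (ι c) (ι a) ℓ)
      ≡⟨ cong (labelAfter Fin._≟_ _ w a) (comap-act G c a ℓ) ⟩
    labelAfter Fin._≟_ (lc Fin._≟_ (comap ι G) c) w a (act Fin._≟_ (comap ι G) c a ℓ) ∎
    where open ≡-Reasoning

-- Exhaustive search over simple graphs on Fin n

record Exhaustible (A : Set) : Set where
  field
    ∀ᵇ       : (A → Bool) → Bool
    ∀ᵇ-sound : ∀ p → T (∀ᵇ p) → ∀ a → T (p a)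
open Exhaustible

exhaustible-⊤ : Exhaustible ⊤
∀ᵇ exhaustible-⊤ p = p tt
∀ᵇ-sound exhaustible-⊤ p h tt = h

exhaustible-Bool : Exhaustible Bool
∀ᵇ exhaustible-Bool p = p true ∧ p false
∀ᵇ-sound exhaustible-Bool p h true  = proj₁ (∧-split h)
∀ᵇ-sound exhaustible-Bool p h false = proj₂ (∧-split {p true} h)

exhaustible-× : ∀ {A B} → Exhaustible A → Exhaustible B → Exhaustible (A × B)
∀ᵇ (exhaustible-× 𝔸 𝔹) p = ∀ᵇ 𝔸 λ a → ∀ᵇ 𝔹 λ b → p (a , b)
∀ᵇ-sound (exhaustible-× 𝔸 𝔹) p h (a , b) = ∀ᵇ-sound 𝔹 _ (∀ᵇ-sound 𝔸 _ h a) b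

exhaustible-Vec : ∀ {A} → Exhaustible A → ∀ m → Exhaustible (Vec A m)
∀ᵇ (exhaustible-Vec 𝔸 zero) p = p []
∀ᵇ (exhaustible-Vec 𝔸 (suc m)) p = ∀ᵇ 𝔸 λ a → ∀ᵇ (exhaustible-Vec 𝔸 m) λ v → p (a ∷ v)
∀ᵇ-sound (exhaustible-Vec 𝔸 zero) p h [] = h
∀ᵇ-sound (exhaustible-Vec 𝔸 (suc m)) p h (a ∷ v) =
  ∀ᵇ-sound (exhaustible-Vec 𝔸 m) _ (∀ᵇ-sound 𝔸 _ h a) v

exhaustible-Fin : ∀ n → Exhaustible (Fin n)
∀ᵇ (exhaustible-Fin zero) p = true
∀ᵇ (exhaustible-Fin (suc n)) p = p zero ∧ ∀ᵇ (exhaustible-Fin n) (p ∘ suc)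
∀ᵇ-sound (exhaustible-Fin (suc n)) p h zero    = proj₁ (∧-split h)
∀ᵇ-sound (exhaustible-Fin (suc n)) p h (suc i) =
  ∀ᵇ-sound (exhaustible-Fin n) _ (proj₂ (∧-split {p zero} h)) i

exhaustible-Label : Exhaustible Label
exhaustible-Label = exhaustible-× exhaustible-Bool exhaustible-Bool

UpperTriangle : ℕ → Set
UpperTriangle zero    = ⊤
UpperTriangle (suc n) = Vec Bool n × UpperTriangle n

exhaustible-UpperTriangle : ∀ n → Exhaustible (UpperTriangle n)
exhaustible-UpperTriangle zero    = exhaustible-⊤
exhaustible-UpperTriangle (suc n) =
  exhaustible-× (exhaustible-Vec exhaustible-Bool n) (exhaustible-UpperTriangle n)

graphOf : ∀ {n} → UpperTriangle n → Graph (Fin n)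
graphOf {suc n} (r , Δ) zero    zero    = false
graphOf {suc n} (r , Δ) zero    (suc j) = lookup r j
graphOf {suc n} (r , Δ) (suc i) zero    = lookup r i
graphOf {suc n} (r , Δ) (suc i) (suc j) = graphOf Δ i j

triangleOf : ∀ {n} → Graph (Fin n) → UpperTriangle n
triangleOf {zero}  K = tt
triangleOf {suc n} K = tabulate (K zero ∘ suc) , triangleOf (λ i j → K (suc i) (suc j))

graphOf-triangleOf : ∀ {n} {K : Graph (Fin n)} → SimpleGraph K → graphOf (triangleOf K) ≐ K
graphOf-triangleOf (symmetric , loopless) zero    zero    = sym (loopless zero)
graphOf-triangleOf                     _ zero    (suc j) = lookup∘tabulate _ j
graphOf-triangleOf (symmetric , loopless) (suc i) zero    =
  trans (lookup∘tabulate _ i) (symmetric zero (suc i))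
graphOf-triangleOf (symmetric , loopless) (suc i) (suc j) =
  graphOf-triangleOf ((λ a b → symmetric (suc a) (suc b)) , loopless ∘ suc) i j

-- Graphs on Fin n are memoised as tables: evaluating a long word of local
-- complementations on the functional representation takes exponential time.
module Tables {n : ℕ} where
  open LocalComplementation (Fin._≟_ {n})

  Table : Set
  Table = Vec (Vec Bool n) n

  entry : Table → Graph (Fin n)
  entry t i j = lookup (lookup t i) j

  tabulateGraph : Graph (Fin n) → Table
  tabulateGraph K = tabulate (tabulate ∘ K)

  entry-tabulateGraph : ∀ K → entry (tabulateGraph K) ≐ K
  entry-tabulateGraph K i j =
    trans (cong (λ r → lookup r j) (lookup∘tabulate _ i)) (lookup∘tabulate (K i) j)

  lcᵀ : Table → Fin n → Table
  lcᵀ t u = tabulateGraph (lc Fin._≟_ (entry t) u)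

  lcWordᵀ : Table → List (Fin n) → Table
  lcWordᵀ = foldl lcᵀ

  labelsᵀ : Table → List (Fin n) → Vec Label n → Vec Label n
  labelsᵀ t []      φ = φ
  labelsᵀ t (u ∷ w) φ = labelsᵀ (lcᵀ t u) w (tabulate λ a → act (entry t) u a (lookup φ a))

  entry-lcWordᵀ : ∀ t w → entry (lcWordᵀ t w) ≐ lcWord Fin._≟_ (entry t) w
  entry-lcWordᵀ t []      a b = refl
  entry-lcWordᵀ t (u ∷ w) a b =
    trans (entry-lcWordᵀ (lcᵀ t u) w a b) (lcWord-cong (entry-tabulateGraph _) w a b)

  lookup-labelsᵀ : ∀ t w φ a → lookup (labelsᵀ t w φ) a ≡ labelAfter (entry t) w a (lookup φ a)
  lookup-labelsᵀ t []      φ a = refl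
  lookup-labelsᵀ t (u ∷ w) φ a = begin
    lookup (labelsᵀ (lcᵀ t u) w φ′) a                ≡⟨ lookup-labelsᵀ (lcᵀ t u) w φ′ a ⟩
    labelAfter (entry (lcᵀ t u)) w a (lookup φ′ a)
      ≡⟨ cong (labelAfter _ w a) (lookup∘tabulate _ a) ⟩
    labelAfter (entry (lcᵀ t u)) w a (act (entry t) u a (lookup φ a))
      ≡⟨ labelAfter-cong (entry-tabulateGraph _) w a _ ⟩
    labelAfter (lc Fin._≟_ (entry t) u) w a (act (entry t) u a (lookup φ a)) ∎
    where
    open ≡-Reasoning
    φ′ = tabulate λ b → act (entry t) u b (lookup φ b)

  unchangedᵇ : Graph (Fin n) → Table → Bool
  unchangedᵇ K t = ∀ᵇ fin λ a → ∀ᵇ fin λ b → ⌊ entry t a b Bool.≟ K a b ⌋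
    where fin = exhaustible-Fin n

  unchangedᵇ-sound : ∀ K t → T (unchangedᵇ K t) → entry t ≐ K
  unchangedᵇ-sound K t h a b =
    toWitness (∀ᵇ-sound fin _ (∀ᵇ-sound fin (λ a → ∀ᵇ fin λ b → ⌊ entry t a b Bool.≟ K a b ⌋) h a) b)
    where fin = exhaustible-Fin n

  constantᵇ : Label → Vec Label n → Bool
  constantᵇ ℓ φ = ∀ᵇ (exhaustible-Fin n) λ a → ⌊ lookup φ a ≟ᴸ ℓ ⌋

  constantᵇ-sound : ∀ ℓ φ → T (constantᵇ ℓ φ) → ∀ a → lookup φ a ≡ ℓ
  constantᵇ-sound ℓ φ h a = toWitness (∀ᵇ-sound (exhaustible-Fin n) (λ a → ⌊ lookup φ a ≟ᴸ ℓ ⌋) h a)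

open Tables

-- Patterns of relators and their verification

Adjacency : ℕ → Set
Adjacency k = Fin k × Fin k × Bool

HoldsIn : ∀ {k} → Graph (Fin k) → Adjacency k → Set
HoldsIn G (i , j , b) = G i j ≡ b

holdsIn? : ∀ {k} (G : Graph (Fin k)) c → Dec (HoldsIn G c)
holdsIn? G (i , j , b) = G i j Bool.≟ b

holdsIn-cong : ∀ {k} {G H : Graph (Fin k)} → G ≐ H → ∀ {c} → HoldsIn G c → HoldsIn H c
holdsIn-cong G≐H {i , j , b} Gij = trans (sym (G≐H i j)) Gij

Satisfies : ∀ {k} → Graph (Fin k) → List (Adjacency k) → Set
Satisfies G = All (HoldsIn G)

record Pattern : Set where
  field
    letters     : ℕ
    word        : List (Fin letters)
    constraints : List (Adjacency letters)

module _ (P : Pattern) where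
  open Pattern P
  open LocalComplementation

  shifted : ∀ e → List (Fin (e + letters))
  shifted e = map (e ↑ʳ_) word

  -- The e extra vertices in front of the letters stand for the vertices observed by a
  -- graph entry (e ≤ 2) or a label (e ≤ 1) that are not letters of the relator.  The graph
  -- and its table are passed to the check as arguments so that each is computed only once.
  everyInstance : ∀ e → (Graph (Fin (e + letters)) → Table → Bool) → Bool
  everyInstance e check = ∀ᵇ (exhaustible-UpperTriangle (e + letters)) (verdict ∘ graphOf)
    where
    verdict : Graph (Fin (e + letters)) → Bool
    verdict K =
      if ⌊ all? (holdsIn? (comap (e ↑ʳ_) K)) constraints ⌋ then check K (tabulateGraph K) else true

  everyInstance-sound : ∀ e check → everyInstance e check ≡ true →
    (K : Graph (Fin (e + letters))) → SimpleGraph K → Satisfies (comap (e ↑ʳ_) K) constraints →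
    T (check (graphOf (triangleOf K)) (tabulateGraph (graphOf (triangleOf K))))
  everyInstance-sound e check h K simple sat =
    if-true (fromWitness (All-map (holdsIn-cong restrict≐) sat))
            (∀ᵇ-sound (exhaustible-UpperTriangle (e + letters)) _
                      (Equivalence.from Bool.T-≡ h) (triangleOf K))
    where
    restrict≐ : comap (e ↑ʳ_) K ≐ comap (e ↑ʳ_) (graphOf (triangleOf K))
    restrict≐ i j = sym (graphOf-triangleOf simple (e ↑ʳ i) (e ↑ʳ j))

  wordFixesGraphᵇ : ∀ e → Graph (Fin (e + letters)) → Table → Bool
  wordFixesGraphᵇ e K t = unchangedᵇ K (lcWordᵀ t (shifted e))

  wordFixesLabelᵇ : ∀ e → Table → Label → Bool
  wordFixesLabelᵇ e t ℓ = constantᵇ ℓ (labelsᵀ t (shifted e) (replicate _ ℓ))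

  graphsFixedOn : ℕ → Bool
  graphsFixedOn e = everyInstance e (wordFixesGraphᵇ e)

  labelsFixedOn : ℕ → Bool
  labelsFixedOn e = everyInstance e λ _ t → ∀ᵇ exhaustible-Label (wordFixesLabelᵇ e t)

  record Verified : Set where
    field
      graphs₀ : graphsFixedOn 0 ≡ true
      graphs₁ : graphsFixedOn 1 ≡ true
      graphs₂ : graphsFixedOn 2 ≡ true
      labels₀ : labelsFixedOn 0 ≡ true
      labels₁ : labelsFixedOn 1 ≡ true

  module _ {e} {K : Graph (Fin (e + letters))} (simple : SimpleGraph K)
           (sat : Satisfies (comap (e ↑ʳ_) K) constraints) where
    private
      Δ = triangleOf K
      t = tabulateGraph (graphOf Δ)
      Δ≐K : graphOf Δ ≐ K
      Δ≐K = graphOf-triangleOf simple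
      K≐t : K ≐ entry t
      K≐t a b = trans (sym (Δ≐K a b)) (sym (entry-tabulateGraph _ a b))

    graphsFixedOn-sound : graphsFixedOn e ≡ true → lcWord Fin._≟_ K (shifted e) ≐ K
    graphsFixedOn-sound h a b = begin
      lcWord Fin._≟_ K (shifted e) a b         ≡⟨ lcWord-cong Fin._≟_ K≐t (shifted e) a b ⟩
      lcWord Fin._≟_ (entry t) (shifted e) a b ≡⟨ sym (entry-lcWordᵀ t (shifted e) a b) ⟩
      entry (lcWordᵀ t (shifted e)) a b
        ≡⟨ unchangedᵇ-sound (graphOf Δ) (lcWordᵀ t (shifted e)) checked a b ⟩
      graphOf Δ a b                            ≡⟨ Δ≐K a b ⟩
      K a b ∎
      where
      open ≡-Reasoning
      checked = everyInstance-sound e (wordFixesGraphᵇ e) h K simple sat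

    labelsFixedOn-sound : labelsFixedOn e ≡ true → ∀ a ℓ → labelAfter Fin._≟_ K (shifted e) a ℓ ≡ ℓ
    labelsFixedOn-sound h a ℓ = begin
      labelAfter Fin._≟_ K (shifted e) a ℓ
        ≡⟨ labelAfter-cong Fin._≟_ K≐t (shifted e) a ℓ ⟩
      labelAfter Fin._≟_ (entry t) (shifted e) a ℓ
        ≡⟨ cong (labelAfter Fin._≟_ (entry t) (shifted e) a) (sym (lookup-replicate a ℓ)) ⟩
      labelAfter Fin._≟_ (entry t) (shifted e) a (lookup (replicate _ ℓ) a)
        ≡⟨ sym (lookup-labelsᵀ t (shifted e) (replicate _ ℓ) a) ⟩
      lookup (labelsᵀ t (shifted e) (replicate _ ℓ)) a
        ≡⟨ constantᵇ-sound ℓ (labelsᵀ t (shifted e) (replicate _ ℓ))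
             (∀ᵇ-sound exhaustible-Label (wordFixesLabelᵇ e t) checked ℓ) a ⟩
      ℓ ∎
      where
      open ≡-Reasoning
      checked : T (∀ᵇ exhaustible-Label (wordFixesLabelᵇ e t))
      checked = everyInstance-sound e (λ _ t → ∀ᵇ exhaustible-Label (wordFixesLabelᵇ e t)) h K simple sat

uu : Pattern
uu = record { letters = 1 ; word = zero ∷ zero ∷ [] ; constraints = [] }

uvuv : Pattern
uvuv = record
  { letters = 2 ; word = u ∷ v ∷ u ∷ v ∷ [] ; constraints = (u , v , false) ∷ [] }
  where
  u v : Fin 2
  u = zero
  v = suc zero

uvuvuv : Pattern
uvuvuv = record
  { letters = 2 ; word = u ∷ v ∷ u ∷ v ∷ u ∷ v ∷ [] ; constraints = (u , v , true) ∷ [] }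
  where
  u v : Fin 2
  u = zero
  v = suc zero

uvuvwvuwu : Pattern
uvuvwvuwu = record
  { letters     = 3
  ; word        = u ∷ v ∷ u ∷ v ∷ w ∷ v ∷ u ∷ w ∷ u ∷ []
  ; constraints = (u , v , true) ∷ (v , w , true) ∷ (u , w , true) ∷ []
  }
  where
  u v w : Fin 3
  u = zero
  v = suc zero
  w = suc (suc zero)

uu-verified : Verified uu
uu-verified = record
  { graphs₀ = refl ; graphs₁ = refl ; graphs₂ = refl ; labels₀ = refl ; labels₁ = refl }

uvuv-verified : Verified uvuv
uvuv-verified = record
  { graphs₀ = refl ; graphs₁ = refl ; graphs₂ = refl ; labels₀ = refl ; labels₁ = refl }

uvuvuv-verified : Verified uvuvuv
uvuvuv-verified = record
  { graphs₀ = refl ; graphs₁ = refl ; graphs₂ = refl ; labels₀ = refl ; labels₁ = refl }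

uvuvwvuwu-verified : Verified uvuvwvuwu
uvuvwvuwu-verified = record
  { graphs₀ = refl ; graphs₁ = refl ; graphs₂ = refl ; labels₀ = refl ; labels₁ = refl }

module Relators {V : Set} (_≟_ : DecidableEquality V) where
  open LocalComplementation _≟_

  locate : ∀ {k} (x : V) (L : Vec V k) → (∃ λ i → lookup L i ≡ x) ⊎ Vec.All (x ≢_) L
  locate x []      = inj₂ Vec.[]
  locate x (y ∷ L) with y ≟ x | locate x L
  ... | yes y≡x | _              = inj₁ (zero , y≡x)
  ... | no _    | inj₁ (i , Li≡x) = inj₁ (suc i , Li≡x)
  ... | no y≢x  | inj₂ x∉L        = inj₂ ((y≢x ∘ sym) Vec.∷ x∉L)

  module _ (P : Pattern) (H : Graph V) (L : Vec V (Pattern.letters P))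
           (simple : SimpleGraph H) (unique : Unique L)
           (sat : Satisfies (comap (lookup L) H) (Pattern.constraints P)) where
    open Pattern P

    module Around {e} (E : Vec V e) (unique′ : Unique (E ++ᵛ L)) where
      ι : Fin (e + letters) → V
      ι = lookup (E ++ᵛ L)

      open Comap _≟_ ι (lookup-injective unique′ _ _)
      open ≡-Reasoning

      word≡ : map (lookup L) word ≡ map ι (shifted P e)
      word≡ = trans (map-cong (sym ∘ lookup-++ʳ E L) word) (map-∘ word)

      K : Graph (Fin (e + letters))
      K = comap ι H

      K-simple : SimpleGraph K
      K-simple = comap-simple ι simple

      K-satisfies : Satisfies (comap (e ↑ʳ_) K) constraints
      K-satisfies = All-map
        (holdsIn-cong (λ i j → sym (cong₂ H (lookup-++ʳ E L i) (lookup-++ʳ E L j)))) sat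

      graph-fixed : graphsFixedOn P e ≡ true → comap ι (lcWord _≟_ H (map (lookup L) word)) ≐ K
      graph-fixed h a b = begin
        lcWord _≟_ H (map (lookup L) word) (ι a) (ι b)
          ≡⟨ cong (λ w → lcWord _≟_ H w (ι a) (ι b)) word≡ ⟩
        lcWord _≟_ H (map ι (shifted P e)) (ι a) (ι b) ≡⟨ comap-lcWord H (shifted P e) a b ⟩
        lcWord Fin._≟_ K (shifted P e) a b             ≡⟨ graphsFixedOn-sound P K-simple K-satisfies h a b ⟩
        K a b ∎

      labels-fixed : labelsFixedOn P e ≡ true → ∀ a ℓ → labelAfter H (map (lookup L) word) (ι a) ℓ ≡ ℓ
      labels-fixed h a ℓ = begin
        labelAfter H (map (lookup L) word) (ι a) ℓ  ≡⟨ cong (λ w → labelAfter H w (ι a) ℓ) word≡ ⟩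
        labelAfter H (map ι (shifted P e)) (ι a) ℓ  ≡⟨ comap-labelAfter H (shifted P e) a ℓ ⟩
        LocalComplementation.labelAfter Fin._≟_ K (shifted P e) a ℓ
          ≡⟨ labelsFixedOn-sound P K-simple K-satisfies h a ℓ ⟩
        ℓ ∎

    open Around

    -- Stated for a word r equal to the spelled-out pattern: comparing lcWord on two
    -- different expressions for a concrete word makes Agda unfold it, in exponential time.
    pattern-fixes : Verified P → ∀ r → map (lookup L) word ≡ r →
      (lcWord _≟_ H r ≐ H) × (∀ x ℓ → labelAfter H r x ℓ ≡ ℓ)
    pattern-fixes verified _ refl = graph-unchanged , labels-unchanged
      where
      open Verified verified

      graph-unchanged : lcWord _≟_ H (map (lookup L) word) ≐ H
      graph-unchanged x y with x ≟ y
      ... | yes refl = trans (proj₂ (lcWord-simple simple (map (lookup L) word)) x) (sym (proj₂ simple x))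
      ... | no x≢y with locate x L | locate y L
      ... | inj₁ (i , refl) | inj₁ (j , refl) = graph-fixed [] unique graphs₀ i j
      ... | inj₂ x∉L | inj₁ (j , refl) = graph-fixed (x ∷ []) (x∉L ∷ unique) graphs₁ zero (suc j)
      ... | inj₁ (i , refl) | inj₂ y∉L = graph-fixed (y ∷ []) (y∉L ∷ unique) graphs₁ (suc i) zero
      ... | inj₂ x∉L | inj₂ y∉L =
        graph-fixed (x ∷ y ∷ []) ((x≢y Vec.∷ x∉L) ∷ y∉L ∷ unique) graphs₂ zero (suc zero)

      labels-unchanged : ∀ x ℓ → labelAfter H (map (lookup L) word) x ℓ ≡ ℓ
      labels-unchanged x ℓ with locate x L
      ... | inj₁ (i , refl) = labels-fixed [] unique labels₀ i ℓ
      ... | inj₂ x∉L        = labels-fixed (x ∷ []) (x∉L ∷ unique) labels₁ zero ℓ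

  relator-fixes : ∀ {H r} → SimpleGraph H → Relator _≟_ H r →
    (lcWord _≟_ H r ≐ H) × (∀ x ℓ → labelAfter H r x ℓ ≡ ℓ)
  relator-fixes {H} {r} S (r-uu u) =
    pattern-fixes uu H (u ∷ []) S (Vec.[] ∷ []) [] uu-verified r refl
  relator-fixes {H} {r} S (r-uvuv u v u≢v uv) =
    pattern-fixes uvuv H (u ∷ v ∷ []) S ((u≢v Vec.∷ Vec.[]) ∷ Vec.[] ∷ []) (uv ∷ []) uvuv-verified r refl
  relator-fixes {H} {r} S (r-uvuvuv u v uv) =
    pattern-fixes uvuvuv H (u ∷ v ∷ []) S ((adjacent⇒≢ S uv Vec.∷ Vec.[]) ∷ Vec.[] ∷ []) (uv ∷ [])
      uvuvuv-verified r refl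
  relator-fixes {H} {r} S (r-uvw u v w uv vw uw) =
    pattern-fixes uvuvwvuwu H (u ∷ v ∷ w ∷ []) S
      ((adjacent⇒≢ S uv Vec.∷ adjacent⇒≢ S uw Vec.∷ Vec.[]) ∷ (adjacent⇒≢ S vw Vec.∷ Vec.[]) ∷ Vec.[] ∷ [])
      (uv ∷ vw ∷ uw ∷ []) uvuvwvuwu-verified r refl

module Letters {V : Set} (_≟_ : DecidableEquality V) where
  open LocalComplementation _≟_
  open Relators _≟_
  open DecMembership _≟_ using (_∈?_)
  open ≡-Reasoning

  relator-cancels : ∀ {G} → SimpleGraph G → ∀ p r q → Relator _≟_ (lcWord _≟_ G p) r →
    ∀ x ℓ → labelAfter G (p ++ r ++ q) x ℓ ≡ labelAfter G (p ++ q) x ℓ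
  relator-cancels {G} simple p r q rel x ℓ = begin
    labelAfter G (p ++ r ++ q) x ℓ                          ≡⟨ labelAfter-++ G p (r ++ q) x ℓ ⟩
    labelAfter Gp (r ++ q) x ℓp                             ≡⟨ labelAfter-++ Gp r q x ℓp ⟩
    labelAfter (lcWord _≟_ Gp r) q x (labelAfter Gp r x ℓp) ≡⟨ cong (labelAfter _ q x) (proj₂ fixes x ℓp) ⟩
    labelAfter (lcWord _≟_ Gp r) q x ℓp                     ≡⟨ labelAfter-cong (proj₁ fixes) q x ℓp ⟩
    labelAfter Gp q x ℓp                                    ≡⟨ labelAfter-++ G p q x ℓ ⟨
    labelAfter G (p ++ q) x ℓ ∎
    where
    Gp = lcWord _≟_ G p
    ℓp = labelAfter G p x ℓ
    fixes = relator-fixes (lcWord-simple simple p) rel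

  loc-preserves-labels : ∀ {G s t} → SimpleGraph G → InLoc _≟_ G s t →
    ∀ x ℓ → labelAfter G s x ℓ ≡ labelAfter G t x ℓ
  loc-preserves-labels simple ε x ℓ = refl
  loc-preserves-labels simple (remove p r q rel ◅ steps) x ℓ =
    trans (relator-cancels simple p r q rel x ℓ) (loc-preserves-labels simple steps x ℓ)
  loc-preserves-labels simple (insert p r q rel ◅ steps) x ℓ =
    trans (sym (relator-cancels simple p r q rel x ℓ)) (loc-preserves-labels simple steps x ℓ)

  private
    bw = blockWord _≟_

  triple-moves-centre : ∀ {H u v} → SimpleGraph H → u ≢ v → H u v ≡ true →
    isInitial (labelAfter H (u ∷ v ∷ u ∷ []) u initial) ≡ false
  triple-moves-centre {H} {u} {v} simple@(symmetric , _) u≢v uv = cong isInitial (begin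
    act H₂ u u (act H₁ v u (act H u u initial))
      ≡⟨ act-self H₂ u _ ⟩
    transvectCentre (act H₁ v u (act H u u initial))
      ≡⟨ cong transvectCentre (act-neighbour H₁ _ u≢v vu) ⟩
    transvectCentre (transvectNeighbour (act H u u initial))
      ≡⟨ cong (transvectCentre ∘ transvectNeighbour) (act-self H u initial) ⟩
    transvectCentre (transvectNeighbour (transvectCentre initial)) ∎)
    where
    H₁ = lc _≟_ H u
    H₂ = lc _≟_ H₁ v
    vu : H₁ v u ≡ true
    vu = trans (lc-at-centre simple u v) (trans (symmetric v u) uv)

  triple-moves-middle : ∀ {H u v} → u ≢ v →
    isInitial (labelAfter H (u ∷ v ∷ u ∷ []) v initial) ≡ false
  triple-moves-middle {H} {u} {v} u≢v = begin
    isInitial (act H₂ u v (act H₁ v v (act H u v initial))) ≡⟨ isInitial-act H₂ _ (u≢v ∘ sym) ⟩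
    isInitial (act H₁ v v (act H u v initial))              ≡⟨ cong isInitial (act-self H₁ v _) ⟩
    isInitial (transvectCentre (act H u v initial))
      ≡⟨ cong (isInitial ∘ transvectCentre) (act-initial H (u≢v ∘ sym)) ⟩
    isInitial (transvectCentre initial) ∎
    where
    H₁ = lc _≟_ H u
    H₂ = lc _≟_ H₁ v

  block-moves : ∀ {H} b → SimpleGraph H → ValidBlock _≟_ H b → ∀ {x} → x ∈ bw b →
    isInitial (labelAfter H (bw b) x initial) ≡ false
  block-moves {H} (single u) _ _ (here refl) = cong isInitial (act-self H u initial)
  block-moves (triple u v) simple (u≢v , uv) (here refl) = triple-moves-centre simple u≢v uv
  block-moves {H} (triple u v) simple (u≢v , uv) (there (here refl)) = triple-moves-middle {H} u≢v
  block-moves (triple u v) simple (u≢v , uv) (there (there (here refl))) =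
    triple-moves-centre simple u≢v uv

  ∉-later-blocks : ∀ {b x} bs → All (DisjointLetters _≟_ b) bs → x ∈ bw b → x ∉ concatMap bw bs
  ∉-later-blocks (c ∷ bs) (b#c ∷ b#bs) x∈b x∈ with ∈-++⁻ (bw c) x∈
  ... | inj₁ x∈c  = b#c _ x∈b x∈c
  ... | inj₂ x∈bs = ∉-later-blocks bs b#bs x∈b x∈bs

  blocks-move : ∀ {H} bs → SimpleGraph H → ValidBlocks _≟_ H bs → AllPairs (DisjointLetters _≟_) bs →
    ∀ {x ℓ} → x ∈ concatMap bw bs → isInitial ℓ ≡ true →
    isInitial (labelAfter H (concatMap bw bs) x ℓ) ≡ false
  blocks-move {H} (b ∷ bs) simple (valid , valids) (b#bs ∷ disjoint) {x} {ℓ} x∈ ℓ-initial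
    rewrite labelAfter-++ H (bw b) (concatMap bw bs) x ℓ with ∈-++⁻ (bw b) x∈
  ... | inj₁ x∈b = begin
    isInitial (labelAfter _ (concatMap bw bs) x (labelAfter H (bw b) x ℓ))
      ≡⟨ labelAfter-∉ _ _ (∉-later-blocks bs b#bs x∈b) ⟩
    isInitial (labelAfter H (bw b) x ℓ)
      ≡⟨ cong (λ ℓ → isInitial (labelAfter H (bw b) x ℓ)) (isInitial⇒≡initial ℓ-initial) ⟩
    isInitial (labelAfter H (bw b) x initial)
      ≡⟨ block-moves b simple valid x∈b ⟩
    false ∎
  ... | inj₂ x∈bs = blocks-move bs (lcWord-simple simple (bw b)) valids disjoint x∈bs
    (trans (labelAfter-∉ H ℓ (λ x∈b → ∉-later-blocks bs b#bs x∈b x∈bs)) ℓ-initial)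

  reduced-moves : ∀ {G s x} → SimpleGraph G → Reduced _≟_ G s → x ∈ s →
    isInitial (labelAfter G s x initial) ≡ false
  reduced-moves simple (bs , refl , valid , disjoint) x∈s = blocks-move bs simple valid disjoint x∈s refl

  letters-⊆ : ∀ {G s t} → SimpleGraph G → Reduced _≟_ G s →
    (∀ x → labelAfter G s x initial ≡ labelAfter G t x initial) → ∀ x → x ∈ s → x ∈ t
  letters-⊆ {G} {s} {t} simple reduced same x x∈s with x ∈? t
  ... | yes x∈t = x∈t
  ... | no x∉t  with () ← begin
    false                                   ≡⟨ reduced-moves simple reduced x∈s ⟨
    isInitial (labelAfter G s x initial)    ≡⟨ cong isInitial (same x) ⟩
    isInitial (labelAfter G t x initial)    ≡⟨ labelAfter-∉ G initial x∉t ⟩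
    true ∎

open Letters

proposition1p5p5 : {V : Set} (_≟_ : DecidableEquality V) (G : Graph V) (s s′ : List V) →
    SimpleGraph G → Reduced _≟_ G s → Reduced _≟_ G s′ → InLoc _≟_ G s s′ →
    SameLetters _≟_ s s′
proposition1p5p5 _≟_ G s s′ simple reduced reduced′ loc x =
  letters-⊆ _≟_ simple reduced same x , letters-⊆ _≟_ simple reduced′ (sym ∘ same) x
  where
  open LocalComplementation _≟_
  same : ∀ y → labelAfter G s y initial ≡ labelAfter G s′ y initial
  same y = loc-preserves-labels _≟_ simple loc y initial
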